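{- For any constant $\epsilon\in(0,1)$, any $\alpha\in(0,1)$ and any $\rho\ge1$, $\textsc{IPR}$ (with consistency parameter $\alpha$, accuracy $\epsilon$ and ratio parameter $\rho$) is a $(1+\epsilon)(1+\alpha)$-consistent partitioning algorithm.
   Context: SSP: $n$ jobs with processing times $p_j\ge0$, $m$ machines with true speeds $s_i>0$; a job set of total processing time $P$ on machine $i$ takes time $P/s_i$; $p(B)=\sum_{j\in B}p_j$. In the partitioning stage the algorithm knows $\mathbf{p}$ and predicted speeds $\hat s_i>0$ and partitions $[n]$ into $m$ disjoint, possibly empty bags; then $\mathbf{s}$ is revealed and bags are assigned whole to machines; makespan $=\max_i\sum_{B\text{ on }i}p(B)/s_i$. $opt(\mathbf{p},\mathbf{s})$: minimum makespan of scheduling the individual jobs with speeds $\mathbf{s}$. A partitioning algorithm is $c$-consistent if the two-stage algorithm that runs it and then assigns the bags optimally given $\mathbf{s}$ has makespan at most $c\cdot opt(\mathbf{p},\mathbf{s})$ whenever $\hat{\mathbf{s}}=\mathbf{s}$. Algorithm $\textsc{IPR}$ with inputs $\mathbf{p}$, $\hat{\mathbf{s}}$ ($\hat s_1\ge\cdots\ge\hat s_m$), $\alpha$, accuracy $\epsilon$, $\rho\ge1$: 1. Compute a partition $B_1,\dots,B_m$ with $p(B_1)\ge\cdots\ge p(B_m)$ and $\max_i p(B_i)/\hat s_i\le(1+\epsilon)\,opt(\mathbf{p},\hat{\mathbf{s}})$; set $\overline{\mathrm{OPT}}_C=\max_i p(B_i)/\hat s_i$ and $\mathcal{M}_i=\{B_i\}$.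 2. While $\max\{p(B):B\in\cup_i\mathcal{M}_i,|B|\ge2\}>\rho\min\{p(B):B\in\cup_i\mathcal{M}_i\}$: let $(\mathcal{M}'_i)=\textsc{LPT-Rebalance}((\mathcal{M}_i))$; if $\max_i\sum_{B\in\mathcal{M}'_i}p(B)/\hat s_i>(1+\alpha)\overline{\mathrm{OPT}}_C$, return the bags in $\cup_i\mathcal{M}_i$; else set $\mathcal{M}_i\leftarrow\mathcal{M}'_i$. 3. Return the bags in $\cup_i\mathcal{M}_i$. $\textsc{LPT-Rebalance}$: let $B_{\min}$ be a bag of minimum processing time; let $\mathcal{M}_{\max}$ be a collection containing a bag with at least two jobs of maximum processing time among such bags; move $B_{\min}$ into $\mathcal{M}_{\max}$; let $J$ be all jobs of $\mathcal{M}_{\max}$, $\ell=|\mathcal{M}_{\max}|$; redistribute $J$ into $\ell$ new bags by LPT (jobs in nonincreasing order of processing time, each to a currently least loaded bag), replacing the bags of $\mathcal{M}_{\max}$.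
   Formalization: The processing times $p_j$, the predicted speeds $\hat s_i$ and the parameters ε, α and ρ take rational values. -}

module Defs where

open import Data.Nat as ℕ using (ℕ; suc)
open import Data.Fin as Fin using (Fin)
import Data.Fin.Properties as FinP
open import Data.List as List using (List; []; _∷_; [_]; length; map; filter; allFin; concat; concatMap; lookup; removeAt; _[_]∷=_; foldr)
open import Data.Vec as Vec using (Vec)
open import Data.Nat.ListAction using (sum)
open import Data.List.Membership.Propositional using (_∈_)
open import Data.List.Relation.Unary.Linked using (Linked)
open import Data.List.Relation.Binary.Permutation.Propositional using (_↭_)
open import Data.Rational as ℚ using (ℚ; 0ℚ; 1ℚ; _+_; _*_; _≤_; _<_; _⊔_; _÷_; ≢-nonZero)
open import Data.Rational.Properties using (_≟_)
open import Data.Product using (Σ; ∃; _×_; _,_)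
open import Relation.Nullary using (¬_; yes; no)
open import Relation.Binary.PropositionalEquality using (_≡_)

-- Division x / q for q ≠ 0 (only ever used with positive speeds q);
-- the value for q = 0 is an irrelevant convention.
_/ₛ_ : ℚ → ℚ → ℚ
x /ₛ q with q ≟ 0ℚ
... | yes _ = 0ℚ
... | no q≢0 = _÷_ x q {{≢-nonZero q≢0}}

Σℚ : List ℚ → ℚ
Σℚ = foldr _+_ 0ℚ

-- maximum over machines Fin m (all quantities maximised are ≥ 0; empty max = 0)
maxF : ∀ {m} → (Fin m → ℚ) → ℚ
maxF {m} f = foldr (λ i acc → f i ⊔ acc) 0ℚ (allFin m)

-- Everything below is relative to n jobs with processing times p and
-- m machines with speeds s (true speeds, or predicted speeds ŝ).
module Sched (n m : ℕ) (p : Fin n → ℚ) (s : Fin m → ℚ) where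

  Bag : Set
  Bag = List (Fin n)

  pB : Bag → ℚ
  pB B = Σℚ (map p B)

  jobMakespan : (Fin n → Fin m) → ℚ
  jobMakespan σ =
    maxF (λ i → Σℚ (map p (filter (λ j → σ j Fin.≟ i) (allFin n))) /ₛ s i)

  bagMakespan : (bags : List Bag) → (Fin (length bags) → Fin m) → ℚ
  bagMakespan bags β =
    maxF (λ i → Σℚ (map (λ k → pB (lookup bags k))
                        (filter (λ k → β k Fin.≟ i) (allFin (length bags)))) /ₛ s i)

  occ : Fin n → Bag → ℕ
  occ j B = length (filter (λ k → k Fin.≟ j) B)

  IsPartition : (Fin m → Bag) → Set
  IsPartition B = ∀ j → sum (map (λ i → occ j (B i)) (allFin m)) ≡ 1

  -- Step 1 of IPR: p(B₁) ≥ … ≥ p(B_m) and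
  -- max_i p(B_i)/s_i ≤ (1+ε)·opt(p,s), where opt(p,s) is the minimum of
  -- jobMakespan over all job schedules σ.
  InitPartition : (ε : ℚ) → (Fin m → Bag) → Set
  InitPartition ε B =
    IsPartition B
    × (∀ (i i' : Fin m) → i Fin.≤ i' → pB (B i') ≤ pB (B i))
    × (∀ (σ : Fin n → Fin m) →
         maxF (λ i → pB (B i) /ₛ s i) ≤ (1ℚ + ε) * jobMakespan σ)

  OPTC : (Fin m → Bag) → ℚ
  OPTC B = maxF (λ i → pB (B i) /ₛ s i)

  State : Set
  State = Fin m → List Bag

  allBags : State → List Bag
  allBags M = concatMap M (allFin m)

  value : State → ℚ
  value M = maxF (λ i → Σℚ (map pB (M i)) /ₛ s i)

  LoopCond : ℚ → State → Set
  LoopCond ρ M = Σ Bag λ B → Σ Bag λ B' →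
    B ∈ allBags M × 2 ℕ.≤ length B × B' ∈ allBags M × ρ * pB B' < pB B

  -- greedy phase of LPT: jobs processed in the given order, each appended to
  -- a currently least loaded bag (ties broken arbitrarily)
  data Greedy {ℓ : ℕ} : List (Fin n) → Vec Bag ℓ → Vec Bag ℓ → Set where
    done : ∀ {bs} → Greedy [] bs bs
    step : ∀ {j js bs out} (k : Fin ℓ) →
           (∀ (k' : Fin ℓ) → pB (Vec.lookup bs k) ≤ pB (Vec.lookup bs k')) →
           Greedy js (Vec.updateAt bs k (λ b → b List.++ [ j ])) out →
           Greedy (j ∷ js) bs out

  LPT : (J : List (Fin n)) (ℓ : ℕ) → Vec Bag ℓ → Set
  LPT J ℓ out = Σ (List (Fin n)) λ js →
    (js ↭ J) × Linked (λ a b → p b ≤ p a) js × Greedy js (Vec.replicate ℓ []) out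

  removeFrom : (M : State) (k : Fin m) → Fin (length (M k)) → State
  removeFrom M k t i with i Fin.≟ k
  ... | yes _ = removeAt (M k) t
  ... | no _  = M i

  -- one LPT-Rebalance step from M to M' (all admissible tie-breaks allowed)
  LPTRebalance : State → State → Set
  LPTRebalance M M' =
    -- B_min = lookup (M k) t, a bag of minimum processing time
    Σ (Fin m) λ k → Σ (Fin (length (M k))) λ t →
    (∀ B → B ∈ allBags M → pB (lookup (M k) t) ≤ pB B) ×
    -- 𝓜_max = 𝓜_c contains a bag Bmax with ≥ 2 jobs of maximum p among such bags
    (Σ (Fin m) λ c → Σ Bag λ Bmax →
      Bmax ∈ M c × 2 ℕ.≤ length Bmax ×
      (∀ B → B ∈ allBags M → 2 ℕ.≤ length B → pB B ≤ pB Bmax) ×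
      -- move B_min into 𝓜_max, then redistribute by LPT
      (let Mrem = removeFrom M k t
           coll = lookup (M k) t ∷ Mrem c
           J = concat coll
       in Σ (Vec Bag (length coll)) λ new →
            LPT J (length coll) new ×
            (∀ i → (i ≡ c → M' i ≡ Vec.toList new) × (¬ i ≡ c → M' i ≡ Mrem i))))

  -- Step 2/3 loop: Loop ocₒ α ρ M out  means that the loop started in state M
  -- (with \overline{OPT}_C = oc) can return the bag list `out`.
  data Loop (oc α ρ : ℚ) : State → List Bag → Set where
    stop-cond : ∀ {M} → ¬ LoopCond ρ M → Loop oc α ρ M (allBags M)
    stop-bad  : ∀ {M M'} → LoopCond ρ M → LPTRebalance M M' →
                (1ℚ + α) * oc < value M' → Loop oc α ρ M (allBags M)
    continue  : ∀ {M M' out} → LoopCond ρ M → LPTRebalance M M' →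
                value M' ≤ (1ℚ + α) * oc → Loop oc α ρ M' out → Loop oc α ρ M out

  IPR : (α ε ρ : ℚ) → List Bag → Set
  IPR α ε ρ out = Σ (Fin m → Bag) λ B →
    InitPartition ε B × Loop (OPTC B) α ρ (λ i → [ B i ]) out

{-# OPTIONS --safe #-}
-- When the prediction is exact, assign every collection 𝓜_i of the final state
-- to machine i: this bag assignment has makespan equal to the value of the state.
-- The loop starts from a state of value \overline{OPT}_C and only commits to states
-- of value at most (1 + α)·\overline{OPT}_C, so the returned state has value at most
-- (1 + α)·\overline{OPT}_C ≤ (1 + α)(1 + ε)·opt.
module Submission where

open import Defs
open import Data.Nat using (ℕ)
open import Data.Fin as Fin using (Fin)
open import Data.List
  using (List; length; []; _∷_; [_]; _++_; map; filter; tabulate; allFin; concatMap; lookup; foldr)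
open import Data.Rational using (ℚ; 0ℚ; 1ℚ; _+_; _*_; _≤_; _<_; _⊔_; nonNegative)
open import Data.Product using (Σ; _×_; _,_; proj₁; proj₂)
open import Data.List.Properties
  using (map-∘; map-id; map-tabulate; foldr-cong; ++-identityʳ; filter-++; filter-all; filter-none)
open import Data.List.Membership.Propositional using (_∈_)
open import Data.List.Membership.Propositional.Properties using (∈-allFin)
open import Data.List.Relation.Unary.All as All using ()
open import Data.List.Relation.Unary.All.Properties as All using ()
open import Data.List.Relation.Unary.Any using (here; there)
open import Data.List.Relation.Unary.Unique.Propositional using (Unique)
open import Data.List.Relation.Unary.Unique.Propositional.Properties using (allFin⁺)
open import Data.List.Relation.Unary.AllPairs using (_∷_)
open import Data.Rational.Properties
  using (≤-refl; ≤-trans; <⇒≤; nonNegative⁻¹; p≤q⇒p≤r⊔q; +-identityʳ; +-monoʳ-≤;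
         *-identityˡ; *-assoc; *-comm; *-monoʳ-≤-nonNeg; *-monoˡ-≤-nonNeg; module ≤-Reasoning)
open import Function using (_∘_; id)
open import Relation.Binary.Definitions using (DecidableEquality)
open import Relation.Binary.PropositionalEquality using (_≡_; refl; sym; trans; cong; cong₂; module ≡-Reasoning)
open import Relation.Nullary using (yes; no; contradiction)
open import Relation.Unary using (Decidable)

maxF-cong : ∀ {m} {f g : Fin m → ℚ} → (∀ i → f i ≡ g i) → maxF f ≡ maxF g
maxF-cong {m} f≗g = foldr-cong (λ i acc → cong (_⊔ acc) (f≗g i)) refl (allFin m)

0≤maxF : ∀ {m} (f : Fin m → ℚ) → 0ℚ ≤ maxF f
0≤maxF {m} f = go (allFin m)
  where
  go : (is : List (Fin m)) → 0ℚ ≤ foldr (λ i acc → f i ⊔ acc) 0ℚ is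
  go []       = ≤-refl
  go (i ∷ is) = p≤q⇒p≤r⊔q (f i) (go is)

module _ {A B : Set} {P : B → Set} (P? : Decidable P) (f : A → B) where

  filter-map : ∀ xs → filter P? (map f xs) ≡ map f (filter (P? ∘ f) xs)
  filter-map [] = refl
  filter-map (x ∷ xs) with P? (f x)
  ... | yes _ = cong (f x ∷_) (filter-map xs)
  ... | no _  = filter-map xs

module _ {L A : Set} (M : L → List A) where

  labelled : List L → List (L × A)
  labelled = concatMap (λ c → map (c ,_) (M c))

  labelPrefix : (xs : List A) {ys : List A} → L → (Fin (length ys) → L) → Fin (length (xs ++ ys)) → L
  labelPrefix []       c f k           = f k
  labelPrefix (x ∷ xs) c f Fin.zero    = c
  labelPrefix (x ∷ xs) c f (Fin.suc k) = labelPrefix xs c f k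

  origin : (cs : List L) → Fin (length (concatMap M cs)) → L
  origin []       ()
  origin (c ∷ cs) = labelPrefix (M c) c (origin cs)

  tabulate-labelPrefix : (xs : List A) {ys : List A} (c : L) (f : Fin (length ys) → L) →
    tabulate (λ k → labelPrefix xs c f k , lookup (xs ++ ys) k)
      ≡ map (c ,_) xs ++ tabulate (λ k → f k , lookup ys k)
  tabulate-labelPrefix []       c f = refl
  tabulate-labelPrefix (x ∷ xs) c f = cong ((c , x) ∷_) (tabulate-labelPrefix xs c f)

  tabulate-origin : (cs : List L) → tabulate (λ k → origin cs k , lookup (concatMap M cs) k) ≡ labelled cs
  tabulate-origin []       = refl
  tabulate-origin (c ∷ cs) =
    trans (tabulate-labelPrefix (M c) c (origin cs)) (cong (map (c ,_) (M c) ++_) (tabulate-origin cs))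

module _ {L : Set} (_≟_ : DecidableEquality L) where

  filter-≟-Unique : ∀ {i cs} → Unique cs → i ∈ cs → filter (_≟ i) cs ≡ [ i ]
  filter-≟-Unique {i} {c ∷ cs} (c∉cs ∷ uniq) i∈c∷cs with c ≟ i | i∈c∷cs
  ... | yes refl | _          = cong (i ∷_) (filter-none (_≟ i) (All.map (λ i≢x x≡i → i≢x (sym x≡i)) c∉cs))
  ... | no c≢i   | here i≡c   = contradiction (sym i≡c) c≢i
  ... | no _     | there i∈cs = filter-≟-Unique uniq i∈cs

  module _ {A : Set} (M : L → List A) (i : L) where

    filter-labelled : ∀ cs → filter ((_≟ i) ∘ proj₁) (labelled M cs) ≡ labelled M (filter (_≟ i) cs)
    filter-labelled []       = refl
    filter-labelled (c ∷ cs) with c ≟ i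
    ... | yes c≡i = trans (filter-++ _ (map (c ,_) (M c)) (labelled M cs))
                          (cong₂ _++_ (filter-all _ (All.map⁺ (All.universal (λ _ → c≡i) (M c))))
                                      (filter-labelled cs))
    ... | no c≢i  = trans (filter-++ _ (map (c ,_) (M c)) (labelled M cs))
                          (cong₂ _++_ (filter-none _ (All.map⁺ (All.universal (λ _ → c≢i) (M c))))
                                      (filter-labelled cs))

    lookup-origin : ∀ {cs} → Unique cs → i ∈ cs →
      map (lookup (concatMap M cs)) (filter ((_≟ i) ∘ origin M cs) (allFin _)) ≡ M i
    lookup-origin {cs} uniq i∈cs = begin
      map (proj₂ ∘ F) (filter (P? ∘ F) (allFin _))     ≡⟨ map-∘ (filter (P? ∘ F) (allFin _)) ⟩
      map proj₂ (map F (filter (P? ∘ F) (allFin _)))   ≡⟨ cong (map proj₂) (filter-map P? F (allFin _)) ⟨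
      map proj₂ (filter P? (map F (allFin _)))         ≡⟨ cong (map proj₂ ∘ filter P?) (trans (map-tabulate id F) (tabulate-origin M cs)) ⟩
      map proj₂ (filter P? (labelled M cs))            ≡⟨ cong (map proj₂) (filter-labelled cs) ⟩
      map proj₂ (labelled M (filter (_≟ i) cs))        ≡⟨ cong (map proj₂ ∘ labelled M) (filter-≟-Unique uniq i∈cs) ⟩
      map proj₂ (map (i ,_) (M i) ++ [])               ≡⟨ cong (map proj₂) (++-identityʳ _) ⟩
      map proj₂ (map (i ,_) (M i))                     ≡⟨ map-∘ (M i) ⟨
      map id (M i)                                     ≡⟨ map-id (M i) ⟩
      M i                                              ∎
      where
      open ≡-Reasoning
      P? = (_≟ i) ∘ proj₁
      F = λ k → origin M cs k , lookup (concatMap M cs) k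

1≤1+α : ∀ {α} → 0ℚ ≤ α → 1ℚ ≤ 1ℚ + α
1≤1+α 0≤α = +-monoʳ-≤ 1ℚ 0≤α

module _ (n m : ℕ) (p : Fin n → ℚ) (s : Fin m → ℚ) where
  open Sched n m p s

  byCollection : (M : State) → Fin (length (allBags M)) → Fin m
  byCollection M = origin M (allFin m)

  bagMakespan-byCollection : (M : State) → bagMakespan (allBags M) (byCollection M) ≡ value M
  bagMakespan-byCollection M = maxF-cong λ i →
    cong (λ loads → Σℚ loads /ₛ s i)
         (trans (map-∘ _) (cong (map pB) (lookup-origin Fin._≟_ M i (allFin⁺ m) (∈-allFin i))))

  value-initial : (B : Fin m → Bag) → value (λ i → [ B i ]) ≡ OPTC B
  value-initial B = maxF-cong λ i → cong (_/ₛ s i) (+-identityʳ (pB (B i)))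

  Loop-output : ∀ {oc α ρ M out} → Loop oc α ρ M out → value M ≤ (1ℚ + α) * oc →
    Σ State λ M* → out ≡ allBags M* × value M* ≤ (1ℚ + α) * oc
  Loop-output {M = M} (stop-cond _)              bound = M , refl , bound
  Loop-output {M = M} (stop-bad _ _ _)           bound = M , refl , bound
  Loop-output         (continue _ _ bound′ loop) _     = Loop-output loop bound′

  initial-value≤ : ∀ {α} → 0ℚ ≤ α → (B : Fin m → Bag) → value (λ i → [ B i ]) ≤ (1ℚ + α) * OPTC B
  initial-value≤ {α} 0≤α B = begin
    value (λ i → [ B i ])  ≡⟨ value-initial B ⟩
    OPTC B                 ≡⟨ *-identityˡ (OPTC B) ⟨
    1ℚ * OPTC B            ≤⟨ *-monoʳ-≤-nonNeg (OPTC B) {{nonNegative (0≤maxF (λ i → pB (B i) /ₛ s i))}} (1≤1+α 0≤α) ⟩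
    (1ℚ + α) * OPTC B      ∎
    where open ≤-Reasoning

  IPR-consistent : ∀ α ε ρ {out} → 0ℚ ≤ α → IPR α ε ρ out →
    Σ (Fin (length out) → Fin m) λ β →
      ∀ σ → bagMakespan out β ≤ ((1ℚ + ε) * (1ℚ + α)) * jobMakespan σ
  IPR-consistent α ε ρ 0≤α (B , (_ , _ , OPTC≤) , loop)
    with Loop-output loop (initial-value≤ 0≤α B)
  ... | M* , refl , value≤ = byCollection M* , λ σ → begin
    bagMakespan (allBags M*) (byCollection M*)  ≡⟨ bagMakespan-byCollection M* ⟩
    value M*                                    ≤⟨ value≤ ⟩
    (1ℚ + α) * OPTC B                           ≤⟨ *-monoˡ-≤-nonNeg (1ℚ + α) {{nonNegative 0≤1+α}} (OPTC≤ σ) ⟩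
    (1ℚ + α) * ((1ℚ + ε) * jobMakespan σ)       ≡⟨ *-assoc (1ℚ + α) (1ℚ + ε) _ ⟨
    ((1ℚ + α) * (1ℚ + ε)) * jobMakespan σ       ≡⟨ cong (_* jobMakespan σ) (*-comm (1ℚ + α) (1ℚ + ε)) ⟩
    ((1ℚ + ε) * (1ℚ + α)) * jobMakespan σ       ∎
    where
    open ≤-Reasoning
    0≤1+α : 0ℚ ≤ 1ℚ + α
    0≤1+α = ≤-trans (nonNegative⁻¹ 1ℚ) (1≤1+α 0≤α)

lemma1 : (n m : ℕ) (p : Fin n → ℚ) (ŝ : Fin m → ℚ) (ε α ρ : ℚ) →
         0ℚ < ε → ε < 1ℚ → 0ℚ < α → α < 1ℚ → 1ℚ ≤ ρ →
         (∀ j → 0ℚ ≤ p j) → (∀ i → 0ℚ < ŝ i) →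
         (∀ (i i' : Fin m) → i Fin.≤ i' → ŝ i' ≤ ŝ i) →
         (out : List (List (Fin n))) → Sched.IPR n m p ŝ α ε ρ out →
         Σ (Fin (length out) → Fin m) λ β →
           ∀ (σ : Fin n → Fin m) →
             Sched.bagMakespan n m p ŝ out β
               ≤ ((1ℚ + ε) * (1ℚ + α)) * Sched.jobMakespan n m p ŝ σ
lemma1 n m p ŝ ε α ρ _ _ 0<α _ _ _ _ _ _ ipr = IPR-consistent n m p ŝ α ε ρ (<⇒≤ 0<α) ipr
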